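{- For every $(x,y)\in\mathbb{Z}_{\geq0}^2$ with $(x,y)\notin P_1$, some position reachable from $(x,y)$ in one queen move lies in $P_1$.
   Context: $\phi=\frac{1+\sqrt5}2$. Queen moves from $(x,y)$: to $(u,y)$ with $0\le u<x$, to $(x,v)$ with $0\le v<y$, or to $(x-t,y-t)$ with $1\le t\le\min(x,y)$. $g:\mathbb{Z}_{\geq0}\to\{0,1\}$ is defined by $g(0)=1$, $g(1)=0$ and, for $n\ge2$, $g(n)=1-g(m)$ if there is $m\in\mathbb{Z}_{\geq0}$ with $\lfloor n\phi\rfloor=\lfloor m(\phi+1)\rfloor+1$, and $g(n)=1$ otherwise. $P_1=\{(\lfloor n\phi\rfloor+g(n)-1,\lfloor n(\phi+1)\rfloor+g(n)):n\ge0\}\cup\{(\lfloor n(\phi+1)\rfloor+g(n),\lfloor n\phi\rfloor+g(n)-1):n\ge0\}\cup\{(0,0),(1,1)\}$. -}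

module Defs where

open import Data.Nat using (ℕ; zero; suc; _+_; _*_; _∸_; _≤_; _<_; _≤ᵇ_)
open import Data.Nat.DivMod using (_/_)
open import Data.Bool using (if_then_else_)
open import Data.Product using (_×_; ∃; ∃-syntax)
open import Data.Sum using (_⊎_)
open import Relation.Binary.PropositionalEquality using (_≡_; _≢_)

isqrt : ℕ → ℕ
isqrt zero = zero
isqrt (suc m) with isqrt m
... | r = if suc r * suc r ≤ᵇ suc m then suc r else r

-- ⌊ n φ ⌋ = ⌊ (n + √5 n) / 2 ⌋ = ⌊ (n + ⌊ √(5 n²) ⌋) / 2 ⌋
floorPhi : ℕ → ℕ
floorPhi n = (n + isqrt (5 * (n * n))) / 2

-- ⌊ n (φ + 1) ⌋ = ⌊ n φ ⌋ + n
floorPhi1 : ℕ → ℕ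
floorPhi1 n = floorPhi n + n

-- The defining conditions of g (values of g are 0/1 as natural numbers).
IsG : (ℕ → ℕ) → Set
IsG g =
  g 0 ≡ 1 × g 1 ≡ 0 ×
  (∀ n → 2 ≤ n →
     (∀ m → floorPhi n ≡ floorPhi1 m + 1 → g n ≡ 1 ∸ g m) ×
     ((∀ m → floorPhi n ≢ floorPhi1 m + 1) → g n ≡ 1))

InP1 : (ℕ → ℕ) → ℕ → ℕ → Set
InP1 g x y =
  (∃[ n ] (x ≡ (floorPhi n + g n) ∸ 1 × y ≡ floorPhi1 n + g n)) ⊎
  (∃[ n ] (x ≡ floorPhi1 n + g n × y ≡ (floorPhi n + g n) ∸ 1)) ⊎
  (x ≡ 0 × y ≡ 0) ⊎
  (x ≡ 1 × y ≡ 1)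

QueenMove : ℕ → ℕ → ℕ → ℕ → Set
QueenMove x y u v =
  (u < x × v ≡ y) ⊎
  (u ≡ x × v < y) ⊎
  (∃[ t ] (1 ≤ t × t ≤ x × t ≤ y × u ≡ x ∸ t × v ≡ y ∸ t))

{-# OPTIONS --safe #-}

-- Write c n = ⌊nφ⌋ + g n − 1. Then P₁ consists of (0,0), (1,1), the pairs (c n, c n + n + 1) and their
-- mirror images; c is monotone, and every x ≥ 2 equals some c m or some c m + m + 1. Indeed, by Beatty's
-- theorem x is ⌊mφ⌋ or ⌊mφ⌋ + m, and the rule defining g makes the shifts match up: when g m = 1 lifts
-- c m + m + 1 from ⌊mφ⌋ + m to ⌊mφ⌋ + m + 1 = ⌊nφ⌋, then g n = 0 lowers c n from ⌊nφ⌋ to ⌊mφ⌋ + m.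
-- Now let (x, x + n + 1) ∉ P₁. If x > c n, move diagonally onto the pair of n. If x < c n, then x ≤ 1
-- (move down to (x, x)), or x = c m with m < n (move down to c m + m + 1), or x = c m + m + 1 (move down
-- to c m). A point (x, x) with x ≥ 2 moves to (1, 1). Inequalities with φ are encoded as quadratic
-- inequalities in ℕ; Beatty's theorem then rests on φ² = φ + 1 and the irrationality of φ.

module Submission where

open import Defs
open import Data.Bool using (true; false)
open import Data.Empty using (⊥-elim)
open import Data.List using (_∷_; [])
open import Data.Nat
open import Data.Nat.DivMod using (m≡m%n+[m/n]*n; m%n<n; m/n*n≤m)
open import Data.Nat.Induction using (<-wellFounded)
open import Data.Nat.Properties
open import Algebra.Properties.CommutativeSemigroup +-commutativeSemigroup using (xy∙z≈xz∙y)
open import Data.Nat.Tactic.RingSolver using (solve)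
open import Data.Product using (∃-syntax; _×_; _,_; proj₁; proj₂)
open import Data.Sum using (_⊎_; inj₁; inj₂; [_,_]′)
import Data.Sum as Sum
open import Function using (_∘_; id)
open import Induction.WellFounded using (Acc; acc)
open import Relation.Binary.Definitions using (tri<; tri≈; tri>)
open import Relation.Binary.PropositionalEquality
open import Relation.Nullary using (¬_; yes; no)
open import Relation.Nullary.Reflects using (ofʸ; ofⁿ)

isqrt-spec : ∀ m → isqrt m * isqrt m ≤ m × m < suc (isqrt m) * suc (isqrt m)
isqrt-spec zero = z≤n , z<s
isqrt-spec (suc m) with isqrt m | isqrt-spec m
... | r | r²≤m , m<[r+1]² with suc r * suc r ≤ᵇ suc m | ≤ᵇ-reflects-≤ (suc r * suc r) (suc m)
...   | true  | ofʸ [r+1]²≤m+1 = [r+1]²≤m+1 , ≤-<-trans m<[r+1]² (*-mono-< (n<1+n (suc r)) (n<1+n (suc r)))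
...   | false | ofⁿ [r+1]²≰m+1 = m≤n⇒m≤1+n r²≤m , ≰⇒> [r+1]²≰m+1

-- a ≤φ· n, a <φ· n and c >φ· n encode a ≤ φ n, a < φ n and φ n < c: φ n is the positive root of X² − n X − n².
infix 4 _≤φ·_ _<φ·_ _>φ·_
_≤φ·_ _<φ·_ _>φ·_ : ℕ → ℕ → Set
a ≤φ· n = a * a ≤ n * a + n * n
a <φ· n = a * a < n * a + n * n
c >φ· n = n * c + n * n < c * c

-- 4 (n a + n² − a²) = 5 n² − (2 a − n)², with w = 2 a − n and both sides moved into ℕ.
completing-square : ∀ {a n w} → a * 2 ≡ n + w → 4 * (a * a) + 5 * (n * n) ≡ 4 * (n * a + n * n) + w * w
completing-square {a} {n} {w} 2a≡n+w = begin
  4 * (a * a) + 5 * (n * n)              ≡⟨ solve (a ∷ n ∷ []) ⟩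
  (a * 2) * (a * 2) + 5 * (n * n)        ≡⟨ cong (λ d → d * d + 5 * (n * n)) 2a≡n+w ⟩
  (n + w) * (n + w) + 5 * (n * n)        ≡⟨ solve (n ∷ w ∷ []) ⟩
  2 * n * (n + w) + 4 * (n * n) + w * w  ≡⟨ cong (λ d → 2 * n * d + 4 * (n * n) + w * w) 2a≡n+w ⟨
  2 * n * (a * 2) + 4 * (n * n) + w * w  ≡⟨ solve (n ∷ a ∷ w ∷ []) ⟩
  4 * (n * a + n * n) + w * w            ∎
  where open ≡-Reasoning

≤φ·-from-square : ∀ {a n w} → a * 2 ≡ n + w → w * w ≤ 5 * (n * n) → a ≤φ· n
≤φ·-from-square {a} {n} {w} 2a≡n+w w²≤5n² =
  *-cancelˡ-≤ 4 (+-cancelʳ-≤ (5 * (n * n)) (4 * (a * a)) (4 * (n * a + n * n)) (begin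
    4 * (a * a) + 5 * (n * n)          ≡⟨ completing-square {a} {n} {w} 2a≡n+w ⟩
    4 * (n * a + n * n) + w * w        ≤⟨ +-monoʳ-≤ (4 * (n * a + n * n)) w²≤5n² ⟩
    4 * (n * a + n * n) + 5 * (n * n)  ∎))
  where open ≤-Reasoning

>φ·-from-square : ∀ {c n w} → c * 2 ≡ n + w → 5 * (n * n) < w * w → c >φ· n
>φ·-from-square {c} {n} {w} 2c≡n+w 5n²<w² =
  *-cancelˡ-< 4 (n * c + n * n) (c * c) (+-cancelʳ-< (5 * (n * n)) (4 * (n * c + n * n)) (4 * (c * c)) (begin-strict
    4 * (n * c + n * n) + 5 * (n * n)  <⟨ +-monoʳ-< (4 * (n * c + n * n)) 5n²<w² ⟩
    4 * (n * c + n * n) + w * w        ≡⟨ completing-square {c} {n} {w} 2c≡n+w ⟨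
    4 * (c * c) + 5 * (n * n)          ∎))
  where open ≤-Reasoning

floorPhi-spec : ∀ n → floorPhi n ≤φ· n × suc (floorPhi n) >φ· n
floorPhi-spec n = lower , upper
  where
  s = isqrt (5 * (n * n))
  a = floorPhi n

  2a≤n+s : a * 2 ≤ n + s
  2a≤n+s = m/n*n≤m (n + s) 2

  n+s<2a+2 : n + s < suc a * 2
  n+s<2a+2 = subst (_< suc a * 2) (sym (m≡m%n+[m/n]*n (n + s) 2)) (+-monoˡ-< (a * 2) (m%n<n (n + s) 2))

  lower : a ≤φ· n
  lower with n ≤? a * 2
  ... | yes n≤2a =
    ≤φ·-from-square {a} {n} (sym (m+[n∸m]≡n n≤2a))
                    (≤-trans (*-mono-≤ w≤s w≤s) (proj₁ (isqrt-spec (5 * (n * n)))))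
    where
    w≤s : a * 2 ∸ n ≤ s
    w≤s = +-cancelˡ-≤ n _ _ (subst (_≤ n + s) (sym (m+[n∸m]≡n n≤2a)) 2a≤n+s)
  ... | no n≰2a = ≤-trans (*-monoˡ-≤ a a≤n) (m≤m+n (n * a) (n * n))
    where
    a≤n : a ≤ n
    a≤n = ≤-trans (m≤m*n a 2) (<⇒≤ (≰⇒> n≰2a))

  upper : suc a >φ· n
  upper = >φ·-from-square {suc a} {n} (sym (m+[n∸m]≡n n≤2a+2))
                          (<-≤-trans (proj₂ (isqrt-spec (5 * (n * n)))) (*-mono-≤ s<w s<w))
    where
    n≤2a+2 : n ≤ suc a * 2
    n≤2a+2 = ≤-trans (m≤m+n n s) (<⇒≤ n+s<2a+2)
    s<w : s < suc a * 2 ∸ n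
    s<w = +-cancelˡ-< n _ _ (subst (n + s <_) (sym (m+[n∸m]≡n n≤2a+2)) n+s<2a+2)

>φ·⇒> : ∀ {c n} → c >φ· n → n < c
>φ·⇒> {c} {n} φn<c = ≰⇒> λ c≤n → <⇒≱ φn<c (≤-trans (*-monoˡ-≤ c c≤n) (m≤m+n (n * c) (n * n)))

>φ·-mono : ∀ {c c′ n} → c >φ· n → c ≤ c′ → c′ >φ· n
>φ·-mono {c} {c′} {n} φn<c c≤c′ with m≤n⇒∃[o]m+o≡n c≤c′
... | d , refl = begin-strict
  n * (c + d) + n * n              ≡⟨ solve (n ∷ c ∷ d ∷ []) ⟩
  (n * c + n * n) + n * d          <⟨ +-monoˡ-< (n * d) φn<c ⟩
  c * c + n * d                    ≤⟨ +-monoʳ-≤ (c * c) (*-monoˡ-≤ d (<⇒≤ (>φ·⇒> {c} {n} φn<c))) ⟩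
  c * c + c * d                    ≤⟨ +-monoʳ-≤ (c * c) (m≤m+n (c * d) (c * d + d * d)) ⟩
  c * c + (c * d + (c * d + d * d)) ≡⟨ solve (c ∷ d ∷ []) ⟩
  (c + d) * (c + d)                ∎
  where open ≤-Reasoning

≤φ·⇒≤floorPhi : ∀ {a n} → a ≤φ· n → a ≤ floorPhi n
≤φ·⇒≤floorPhi {a} {n} a≤φn =
  ≮⇒≥ λ floor<a → <⇒≱ (>φ·-mono {n = n} (proj₂ (floorPhi-spec n)) floor<a) a≤φn

>φ·⇒floorPhi< : ∀ {c n} → c >φ· n → floorPhi n < c
>φ·⇒floorPhi< {c} {n} φn<c =
  ≰⇒> λ c≤floor → <⇒≱ (>φ·-mono {c} {n = n} φn<c c≤floor) (proj₁ (floorPhi-spec n))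

floorPhi-unique : ∀ {a n} → a ≤φ· n → suc a >φ· n → floorPhi n ≡ a
floorPhi-unique {a} {n} a≤φn φn<a+1 =
  ≤-antisym (≤-pred (>φ·⇒floorPhi< {suc a} {n} φn<a+1)) (≤φ·⇒≤floorPhi {a} {n} a≤φn)

2n+1>φ·n : ∀ n → suc (2 * n) >φ· n
2n+1>φ·n n = begin-strict
  n * suc (2 * n) + n * n                          <⟨ m<m+n _ z<s ⟩
  n * suc (2 * n) + n * n + suc (n * n + 3 * n)    ≡⟨ solve (n ∷ []) ⟩
  suc (2 * n) * suc (2 * n)                        ∎
  where open ≤-Reasoning

≤φ·⇒≤2* : ∀ {a n} → a ≤φ· n → a ≤ 2 * n
≤φ·⇒≤2* {a} {n} a≤φn = ≮⇒≥ λ 2n<a → <⇒≱ (>φ·-mono {n = n} (2n+1>φ·n n) 2n<a) a≤φn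

>φ·⇒4*<3* : ∀ {c n} → c >φ· n → 4 * n < 3 * c
>φ·⇒4*<3* {c} {n} φn<c = ≰⇒> λ 3c≤4n → <⇒≱ φn<c (*-cancelˡ-≤ 3 (begin
  3 * (c * c)               ≡⟨ solve (c ∷ []) ⟩
  (3 * c) * c               ≤⟨ *-monoˡ-≤ c 3c≤4n ⟩
  (4 * n) * c               ≡⟨ solve (n ∷ c ∷ []) ⟩
  3 * (n * c) + n * c       ≤⟨ +-monoʳ-≤ (3 * (n * c)) (*-monoʳ-≤ n (c≤3n 3c≤4n)) ⟩
  3 * (n * c) + n * (3 * n) ≡⟨ solve (n ∷ c ∷ []) ⟩
  3 * (n * c + n * n)       ∎))
  where
  open ≤-Reasoning
  c≤3n : 3 * c ≤ 4 * n → c ≤ 3 * n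
  c≤3n 3c≤4n =
    *-cancelˡ-≤ 3 (≤-trans 3c≤4n (≤-trans (*-monoˡ-≤ n (≤ᵇ⇒≤ 4 9 _)) (≤-reflexive (*-assoc 3 3 n))))

≤φ·-suc : ∀ {a n} → a ≤φ· n → suc a ≤φ· suc n
≤φ·-suc {a} {n} a≤φn = begin
  suc a * suc a                              ≡⟨ solve (a ∷ []) ⟩
  a * a + (a + suc a)                        ≤⟨ +-mono-≤ a≤φn (+-monoʳ-≤ a (s≤s a≤3n+1)) ⟩
  (n * a + n * n) + (a + suc (3 * n + 1))    ≡⟨ solve (n ∷ a ∷ []) ⟩
  suc n * suc a + suc n * suc n              ∎
  where
  open ≤-Reasoning
  a≤3n+1 : a ≤ 3 * n + 1
  a≤3n+1 =
    ≤-trans (≤φ·⇒≤2* {a} {n} a≤φn) (≤-trans (*-monoˡ-≤ n (≤ᵇ⇒≤ 2 3 _)) (m≤m+n (3 * n) 1))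

>φ·-suc : ∀ {c n} → c >φ· n → 2 + c >φ· suc n
>φ·-suc {c} {n} φn<c = begin-strict
  suc n * (2 + c) + suc n * suc n          ≡⟨ solve (n ∷ c ∷ []) ⟩
  (n * c + n * n) + (4 * n + (3 + c))      <⟨ +-mono-<-≤ φn<c (+-monoˡ-≤ (3 + c) 4n≤3c+1) ⟩
  c * c + (suc (3 * c) + (3 + c))          ≡⟨ solve (c ∷ []) ⟩
  (2 + c) * (2 + c)                        ∎
  where
  open ≤-Reasoning
  4n≤3c+1 : 4 * n ≤ suc (3 * c)
  4n≤3c+1 = m<n⇒m≤1+n (>φ·⇒4*<3* {c} {n} φn<c)

-- (k + m)/m = 1 + k/m, and x ↦ 1 + 1/x fixes φ and reverses order.
golden-shift : ∀ k m → (k + m) * (k + m) + m * m ≡ (m * (k + m) + m * m) + (k * m + k * k)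
golden-shift k m = solve (k ∷ m ∷ [])

>φ·-shift : ∀ {k m} → k + m >φ· m → m <φ· k
>φ·-shift {k} {m} φm<k+m = +-cancelˡ-< (m * (k + m) + m * m) (m * m) (k * m + k * k) (begin-strict
  (m * (k + m) + m * m) + m * m             <⟨ +-monoˡ-< (m * m) φm<k+m ⟩
  (k + m) * (k + m) + m * m                 ≡⟨ golden-shift k m ⟩
  (m * (k + m) + m * m) + (k * m + k * k)   ∎)
  where open ≤-Reasoning

<φ·-shift : ∀ {k m} → k + m <φ· m → m >φ· k
<φ·-shift {k} {m} k+m<φm = +-cancelˡ-< (m * (k + m) + m * m) (k * m + k * k) (m * m) (begin-strict
  (m * (k + m) + m * m) + (k * m + k * k)   ≡⟨ golden-shift k m ⟨
  (k + m) * (k + m) + m * m                 <⟨ +-monoˡ-< (m * m) k+m<φm ⟩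
  (m * (k + m) + m * m) + m * m             ∎)
  where open ≤-Reasoning

-- Euclid's descent: a solution (a, n) yields the smaller solution (n, a − n).
φ-irrational : ∀ {a n} → 0 < n → a * a ≢ n * a + n * n
φ-irrational {a} = descend (<-wellFounded a)
  where
  descend : ∀ {a n} → Acc _<_ a → 0 < n → a * a ≢ n * a + n * n
  descend {a} {n} (acc smaller) 0<n a²≡na+n² = descend (smaller n<a) 0<k n²≡kn+k²
    where
    n<a : n < a
    n<a = *-cancelʳ-< a n a (begin-strict
      n * a          <⟨ m<m+n (n * a) (*-mono-< 0<n 0<n) ⟩
      n * a + n * n  ≡⟨ a²≡na+n² ⟨
      a * a          ∎)
      where open ≤-Reasoning
    k = a ∸ n
    0<k : 0 < k
    0<k = m<n⇒0<n∸m n<a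
    k+n≡a : k + n ≡ a
    k+n≡a = m∸n+n≡m (<⇒≤ n<a)
    n²≡kn+k² : n * n ≡ k * n + k * k
    n²≡kn+k² = +-cancelˡ-≡ (n * (k + n) + n * n) (n * n) (k * n + k * k) (begin
      (n * (k + n) + n * n) + n * n            ≡⟨ cong (_+ n * n) [k+n]²≡n[k+n]+n² ⟨
      (k + n) * (k + n) + n * n                ≡⟨ golden-shift k n ⟩
      (n * (k + n) + n * n) + (k * n + k * k)  ∎)
      where
      open ≡-Reasoning
      [k+n]²≡n[k+n]+n² : (k + n) * (k + n) ≡ n * (k + n) + n * n
      [k+n]²≡n[k+n]+n² = subst (λ a → a * a ≡ n * a + n * n) (sym k+n≡a) a²≡na+n²

≤φ·⇒<φ· : ∀ {a n} → 0 < n → a ≤φ· n → a <φ· n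
≤φ·⇒<φ· 0<n a≤φn = ≤∧≢⇒< a≤φn (φ-irrational 0<n)

Gapped : ℕ → (ℕ → ℕ) → Set
Gapped d f = ∀ n → d + f n ≤ f (suc n)

gapped-mono : ∀ {d} f → Gapped d f → ∀ {m n} → m < n → d + f m ≤ f n
gapped-mono {d} f step {m} {suc n} (s≤s m≤n) with m≤n⇒m<n∨m≡n m≤n
... | inj₁ m<n  = ≤-trans (gapped-mono f step m<n) (≤-trans (m≤n+m (f n) d) (step n))
... | inj₂ refl = step m

bracket : ∀ f → f 0 ≡ 0 → Gapped 1 f → ∀ x → ∃[ m ] f m ≤ x × x < f (suc m)
bracket f f0≡0 step zero = 0 , ≤-reflexive f0≡0 , subst (_< f 1) f0≡0 (step 0)
bracket f f0≡0 step (suc x) with bracket f f0≡0 step x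
... | m , fm≤x , x<fm+1 with suc x <? f (suc m)
...   | yes x+1<fm+1 = m , m≤n⇒m≤1+n fm≤x , x+1<fm+1
...   | no  x+1≮fm+1 = suc m , ≮⇒≥ x+1≮fm+1 , ≤-<-trans x<fm+1 (step (suc m))

2-gapped⇒≢suc : ∀ f → Gapped 2 f → ∀ k m → f k ≢ suc (f m)
2-gapped⇒≢suc f step k m fk≡fm+1 with <-cmp k m
... | tri< k<m _ _ = <-asym (≤-trans (n≤1+n _) (gapped-mono f step k<m)) (≤-reflexive (sym fk≡fm+1))
... | tri≈ _ refl _ = 1+n≢n (sym fk≡fm+1)
... | tri> _ _ m<k = <-irrefl refl (≤-trans (gapped-mono f step m<k) (≤-reflexive fk≡fm+1))

floorPhi-gapped : Gapped 1 floorPhi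
floorPhi-gapped n =
  ≤φ·⇒≤floorPhi {suc (floorPhi n)} {suc n} (≤φ·-suc {floorPhi n} {n} (proj₁ (floorPhi-spec n)))

floorPhi-suc≤2+ : ∀ n → floorPhi (suc n) ≤ 2 + floorPhi n
floorPhi-suc≤2+ n =
  ≤-pred (>φ·⇒floorPhi< {3 + floorPhi n} {suc n} (>φ·-suc {suc (floorPhi n)} {n} (proj₂ (floorPhi-spec n))))

n≤floorPhi : ∀ n → n ≤ floorPhi n
n≤floorPhi n = ≤φ·⇒≤floorPhi {n} {n} (m≤n+m (n * n) (n * n))

floorPhi1-gapped : Gapped 2 floorPhi1
floorPhi1-gapped n = begin
  2 + (floorPhi n + n)          ≡⟨ cong suc (+-suc (floorPhi n) n) ⟨
  suc (floorPhi n) + suc n      ≤⟨ +-monoˡ-≤ (suc n) (floorPhi-gapped n) ⟩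
  floorPhi (suc n) + suc n      ∎
  where open ≤-Reasoning

-- With k = x − m, ⌊kφ⌋ = m follows from ⌊mφ⌋ = x − 1 and ⌊(m + 1)φ⌋ = x + 1 by the shift lemmas.
between-floorPhi : ∀ {m x} → floorPhi m < x → x < floorPhi (suc m) → ∃[ k ] floorPhi1 k ≡ x
between-floorPhi {m} {x} Am<x x<Am+1 = k , trans (cong (_+ k) Ak≡m) (trans (+-comm m k) k+m≡x)
  where
  Am+1≡x : suc (floorPhi m) ≡ x
  Am+1≡x = ≤-antisym Am<x (≤-pred (≤-trans x<Am+1 (floorPhi-suc≤2+ m)))
  x+1≡A[m+1] : suc x ≡ floorPhi (suc m)
  x+1≡A[m+1] = ≤-antisym x<Am+1 (≤-trans (floorPhi-suc≤2+ m) (≤-reflexive (cong suc Am+1≡x)))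
  k = x ∸ m
  k+m≡x : k + m ≡ x
  k+m≡x = m∸n+n≡m (≤-trans (n≤floorPhi m) (<⇒≤ Am<x))
  m<φk : m <φ· k
  m<φk = >φ·-shift {k} {m} (subst (_>φ· m) (trans Am+1≡x (sym k+m≡x)) (proj₂ (floorPhi-spec m)))
  A[m+1]≡k+[m+1] : floorPhi (suc m) ≡ k + suc m
  A[m+1]≡k+[m+1] = trans (sym x+1≡A[m+1]) (trans (cong suc (sym k+m≡x)) (sym (+-suc k m)))
  A[m+1]<φ[m+1] : floorPhi (suc m) <φ· suc m
  A[m+1]<φ[m+1] = ≤φ·⇒<φ· {floorPhi (suc m)} {suc m} z<s (proj₁ (floorPhi-spec (suc m)))
  φk<m+1 : suc m >φ· k
  φk<m+1 = <φ·-shift {k} {suc m} (subst (_<φ· suc m) A[m+1]≡k+[m+1] A[m+1]<φ[m+1])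
  Ak≡m : floorPhi k ≡ m
  Ak≡m = floorPhi-unique {m} {k} (<⇒≤ m<φk) φk<m+1

floorPhi-or-floorPhi1 : ∀ x → (∃[ m ] floorPhi m ≡ x) ⊎ (∃[ k ] floorPhi1 k ≡ x)
floorPhi-or-floorPhi1 x = split (bracket floorPhi refl floorPhi-gapped x)
  where
  split : ∃[ m ] floorPhi m ≤ x × x < floorPhi (suc m) →
          (∃[ m ] floorPhi m ≡ x) ⊎ (∃[ k ] floorPhi1 k ≡ x)
  split (m , Am≤x , x<Am+1) with m≤n⇒m<n∨m≡n Am≤x
  ... | inj₁ Am<x = inj₂ (between-floorPhi {m} Am<x x<Am+1)
  ... | inj₂ Am≡x = inj₁ (m , Am≡x)

vertical-move : ∀ {x y v} → v < y → QueenMove x y x v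
vertical-move v<y = inj₂ (inj₁ (refl , v<y))

diagonal-move : ∀ {u v t} → 0 < t → QueenMove (u + t) (v + t) u v
diagonal-move {u} {v} {t} 0<t =
  inj₂ (inj₂ (t , 0<t , m≤n+m t u , m≤n+m t v , sym (m+n∸n≡m u t) , sym (m+n∸n≡m v t)))

QueenMove-sym : ∀ {x y u v} → QueenMove x y u v → QueenMove y x v u
QueenMove-sym (inj₁ (u<x , v≡y))        = inj₂ (inj₁ (v≡y , u<x))
QueenMove-sym (inj₂ (inj₁ (u≡x , v<y))) = inj₁ (v<y , u≡x)
QueenMove-sym (inj₂ (inj₂ (t , 0<t , t≤x , t≤y , u≡x∸t , v≡y∸t))) =
  inj₂ (inj₂ (t , 0<t , t≤y , t≤x , v≡y∸t , u≡x∸t))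

PairCoordinate : (ℕ → ℕ) → ℕ → Set
PairCoordinate c x = (∃[ m ] c m ≡ x) ⊎ (∃[ m ] c m + suc m ≡ x)

module QueenMoveInto
  (P : ℕ → ℕ → Set) (P-sym : ∀ {x y} → P x y → P y x) (P-00 : P 0 0) (P-11 : P 1 1)
  (c : ℕ → ℕ) (P-pair : ∀ n → P (c n) (c n + suc n)) (c-mono : ∀ {m n} → m ≤ n → c m ≤ c n)
  (c-cover : ∀ x → 2 ≤ x → PairCoordinate c x)
  where

  Reach : ℕ → ℕ → Set
  Reach x y = ∃[ u ] ∃[ v ] (QueenMove x y u v × P u v)

  Reach-sym : ∀ {x y} → Reach x y → Reach y x
  Reach-sym (u , v , move , Puv) = v , u , QueenMove-sym move , P-sym Puv

  reach-below-pair : ∀ n x → x < c n → Reach x (x + suc n)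
  reach-below-pair n 0 _ = 0 , 0 , vertical-move z<s , P-00
  reach-below-pair n 1 _ = 1 , 1 , vertical-move (s≤s (s≤s z≤n)) , P-11
  reach-below-pair n x@(suc (suc _)) x<cn with c-cover x (s≤s (s≤s z≤n))
  ... | inj₁ (m , cm≡x) = subst (λ x → Reach x (x + suc n)) cm≡x
          (c m , c m + suc m , vertical-move (+-monoʳ-< (c m) (s≤s m<n)) , P-pair m)
    where
    m<n : m < n
    m<n = ≰⇒> λ n≤m → <⇒≱ x<cn (≤-trans (c-mono n≤m) (≤-reflexive cm≡x))
  ... | inj₂ (m , em≡x) = subst (λ x → Reach x (x + suc n)) em≡x
          (c m + suc m , c m , vertical-move cm<cm+m+1+n+1 , P-sym (P-pair m))
    where
    cm<cm+m+1+n+1 : c m < c m + suc m + suc n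
    cm<cm+m+1+n+1 = <-≤-trans (m<m+n (c m) z<s) (m≤m+n (c m + suc m) (suc n))

  reach-beyond-pair : ∀ n x → c n < x → Reach x (x + suc n)
  reach-beyond-pair n x cn<x = c n , c n + suc n , move , P-pair n
    where
    cn+t≡x : c n + (x ∸ c n) ≡ x
    cn+t≡x = m+[n∸m]≡n (<⇒≤ cn<x)
    cn+n+1+t≡x+n+1 : c n + suc n + (x ∸ c n) ≡ x + suc n
    cn+n+1+t≡x+n+1 = trans (xy∙z≈xz∙y (c n) (suc n) (x ∸ c n)) (cong (_+ suc n) cn+t≡x)
    move : QueenMove x (x + suc n) (c n) (c n + suc n)
    move = subst₂ (λ x′ y′ → QueenMove x′ y′ (c n) (c n + suc n)) cn+t≡x cn+n+1+t≡x+n+1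
                  (diagonal-move (m<n⇒0<n∸m cn<x))

  above-diagonal-at : ∀ n x → P x (x + suc n) ⊎ Reach x (x + suc n)
  above-diagonal-at n x with <-cmp x (c n)
  ... | tri< x<cn _ _ = inj₂ (reach-below-pair n x x<cn)
  ... | tri≈ _ refl _ = inj₁ (P-pair n)
  ... | tri> _ _ cn<x = inj₂ (reach-beyond-pair n x cn<x)

  above-diagonal : ∀ {x y} → x < y → P x y ⊎ Reach x y
  above-diagonal {x} x<y with m≤n⇒∃[o]m+o≡n x<y
  ... | n , refl = subst (λ y → P x y ⊎ Reach x y) (+-suc x n) (above-diagonal-at n x)

  on-diagonal : ∀ x → P x x ⊎ Reach x x
  on-diagonal 0 = inj₁ P-00
  on-diagonal 1 = inj₁ P-11
  on-diagonal (suc (suc x)) = inj₂ (1 , 1 , diagonal-move {1} {1} {suc x} z<s , P-11)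

  in-P-or-reach : ∀ x y → P x y ⊎ Reach x y
  in-P-or-reach x y with <-cmp x y
  ... | tri< x<y _ _ = above-diagonal x<y
  ... | tri≈ _ refl _ = on-diagonal x
  ... | tri> _ _ y<x = Sum.map P-sym Reach-sym (above-diagonal y<x)

module _ (g : ℕ → ℕ) (isG : IsG g) where

  g0≡1 : g 0 ≡ 1
  g0≡1 = proj₁ isG

  g1≡0 : g 1 ≡ 0
  g1≡0 = proj₁ (proj₂ isG)

  g-rule : ∀ {n} m → 2 ≤ n → floorPhi n ≡ floorPhi1 m + 1 → g n ≡ 1 ∸ g m
  g-rule m 2≤n = proj₁ (proj₂ (proj₂ isG) _ 2≤n) m

  g-default : ∀ {n} → 2 ≤ n → (∀ m → floorPhi n ≢ floorPhi1 m + 1) → g n ≡ 1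
  g-default 2≤n = proj₂ (proj₂ (proj₂ isG) _ 2≤n)

  g-cases : ∀ n → 2 ≤ n → (∃[ m ] floorPhi n ≡ floorPhi1 m + 1 × g n ≡ 1 ∸ g m) ⊎ g n ≡ 1
  g-cases n 2≤n with anyUpTo? (λ m → floorPhi n ≟ floorPhi1 m + 1) (floorPhi n)
  ... | yes (m , _ , An≡Bm+1) = inj₁ (m , An≡Bm+1 , g-rule m 2≤n An≡Bm+1)
  ... | no ∄m = inj₂ (g-default 2≤n λ m An≡Bm+1 → ∄m (m , m<An An≡Bm+1 , An≡Bm+1))
    where
    m<An : ∀ {m} → floorPhi n ≡ floorPhi1 m + 1 → m < floorPhi n
    m<An {m} An≡Bm+1 =
      ≤-<-trans (m≤n+m m (floorPhi m)) (subst (floorPhi1 m <_) (sym An≡Bm+1) (m<m+n (floorPhi1 m) z<s))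

  g≤1 : ∀ n → g n ≤ 1
  g≤1 0 = ≤-reflexive g0≡1
  g≤1 1 = ≤-trans (≤-reflexive g1≡0) z≤n
  g≤1 n@(suc (suc _)) with g-cases n (s≤s (s≤s z≤n))
  ... | inj₁ (m , _ , gn≡1∸gm) = ≤-trans (≤-reflexive gn≡1∸gm) (m∸n≤m 1 (g m))
  ... | inj₂ gn≡1              = ≤-reflexive gn≡1

  c : ℕ → ℕ
  c n = floorPhi n + g n ∸ 1

  c+suc≡floorPhi1+g : ∀ n → c n + suc n ≡ floorPhi1 n + g n
  c+suc≡floorPhi1+g n = begin
    c n + suc n             ≡⟨ +-assoc (c n) 1 n ⟨
    (c n + 1) + n           ≡⟨ cong (_+ n) (m∸n+n≡m (1≤A+g n)) ⟩
    (floorPhi n + g n) + n  ≡⟨ xy∙z≈xz∙y (floorPhi n) (g n) n ⟩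
    floorPhi1 n + g n       ∎
    where
    open ≡-Reasoning
    1≤A+g : ∀ n → 1 ≤ floorPhi n + g n
    1≤A+g zero    = ≤-reflexive (sym g0≡1)
    1≤A+g (suc n) = ≤-trans (≤-trans (s≤s z≤n) (n≤floorPhi (suc n))) (m≤m+n (floorPhi (suc n)) (g (suc n)))

  c≡floorPhi : ∀ {n} → g n ≡ 1 → c n ≡ floorPhi n
  c≡floorPhi {n} gn≡1 = trans (cong (λ i → floorPhi n + i ∸ 1) gn≡1) (m+n∸n≡m (floorPhi n) 1)

  c-mono : ∀ {m n} → m ≤ n → c m ≤ c n
  c-mono {m} {n} m≤n with m≤n⇒m<n∨m≡n m≤n
  ... | inj₂ refl = ≤-refl
  ... | inj₁ m<n  = ∸-monoˡ-≤ 1 (begin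
    floorPhi m + g m  ≤⟨ +-monoʳ-≤ (floorPhi m) (g≤1 m) ⟩
    floorPhi m + 1    ≡⟨ +-comm (floorPhi m) 1 ⟩
    suc (floorPhi m)  ≤⟨ gapped-mono floorPhi floorPhi-gapped m<n ⟩
    floorPhi n        ≤⟨ m≤m+n (floorPhi n) (g n) ⟩
    floorPhi n + g n  ∎)
    where open ≤-Reasoning

  2≤floorPhi⇒2≤ : ∀ {n} → 2 ≤ floorPhi n → 2 ≤ n
  2≤floorPhi⇒2≤ {0} ()
  2≤floorPhi⇒2≤ {1} (s≤s ())
  2≤floorPhi⇒2≤ {suc (suc _)} _ = s≤s (s≤s z≤n)

  floorPhi-coordinate : ∀ n → 2 ≤ floorPhi n → PairCoordinate c (floorPhi n)
  floorPhi-coordinate n 2≤An with g-cases n (2≤floorPhi⇒2≤ 2≤An)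
  ... | inj₂ gn≡1 = inj₁ (n , c≡floorPhi gn≡1)
  ... | inj₁ (m , An≡Bm+1 , gn≡1∸gm) with n≤1⇒n≡0∨n≡1 (g≤1 m)
  ...   | inj₁ gm≡0 = inj₁ (n , c≡floorPhi (trans gn≡1∸gm (cong (1 ∸_) gm≡0)))
  ...   | inj₂ gm≡1 = inj₂ (m , trans (c+suc≡floorPhi1+g m) (trans (cong (floorPhi1 m +_) gm≡1) (sym An≡Bm+1)))

  successor-of-floorPhi1 : ∀ m → ∃[ n ] floorPhi n ≡ suc (floorPhi1 m)
  successor-of-floorPhi1 m =
    [ id , (λ { (k , Bk≡Bm+1) → ⊥-elim (2-gapped⇒≢suc floorPhi1 floorPhi1-gapped k m Bk≡Bm+1) }) ]′
      (floorPhi-or-floorPhi1 (suc (floorPhi1 m)))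

  floorPhi1-as-c : ∀ m → 2 ≤ floorPhi1 m → g m ≡ 1 → ∃[ n ] c n ≡ floorPhi1 m
  floorPhi1-as-c m 2≤Bm gm≡1 = n , (begin
    floorPhi n + g n ∸ 1       ≡⟨ cong (λ i → floorPhi n + i ∸ 1) gn≡0 ⟩
    floorPhi n + 0 ∸ 1         ≡⟨ cong (λ a → a + 0 ∸ 1) An≡Bm+1 ⟩
    suc (floorPhi1 m) + 0 ∸ 1  ≡⟨ +-identityʳ (floorPhi1 m) ⟩
    floorPhi1 m                ∎)
    where
    open ≡-Reasoning
    n = proj₁ (successor-of-floorPhi1 m)
    An≡Bm+1 : floorPhi n ≡ suc (floorPhi1 m)
    An≡Bm+1 = proj₂ (successor-of-floorPhi1 m)
    2≤n : 2 ≤ n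
    2≤n = 2≤floorPhi⇒2≤ {n} (≤-trans 2≤Bm (≤-trans (n≤1+n (floorPhi1 m)) (≤-reflexive (sym An≡Bm+1))))
    gn≡0 : g n ≡ 0
    gn≡0 = trans (g-rule m 2≤n (trans An≡Bm+1 (+-comm 1 (floorPhi1 m)))) (cong (1 ∸_) gm≡1)

  floorPhi1-coordinate : ∀ m → 2 ≤ floorPhi1 m → PairCoordinate c (floorPhi1 m)
  floorPhi1-coordinate m 2≤Bm with n≤1⇒n≡0∨n≡1 (g≤1 m)
  ... | inj₁ gm≡0 =
    inj₂ (m , trans (c+suc≡floorPhi1+g m) (trans (cong (floorPhi1 m +_) gm≡0) (+-identityʳ (floorPhi1 m))))
  ... | inj₂ gm≡1 = inj₁ (floorPhi1-as-c m 2≤Bm gm≡1)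

  pair-coordinate : ∀ x → 2 ≤ x → PairCoordinate c x
  pair-coordinate x 2≤x =
    [ (λ { (n , An≡x) → subst (PairCoordinate c) An≡x (floorPhi-coordinate n (2≤ An≡x)) })
    , (λ { (m , Bm≡x) → subst (PairCoordinate c) Bm≡x (floorPhi1-coordinate m (2≤ Bm≡x)) })
    ]′ (floorPhi-or-floorPhi1 x)
    where
    2≤ : ∀ {y} → y ≡ x → 2 ≤ y
    2≤ y≡x = subst (2 ≤_) (sym y≡x) 2≤x

  InP1-sym : ∀ {x y} → InP1 g x y → InP1 g y x
  InP1-sym (inj₁ (n , x≡ , y≡))              = inj₂ (inj₁ (n , y≡ , x≡))
  InP1-sym (inj₂ (inj₁ (n , x≡ , y≡)))       = inj₁ (n , y≡ , x≡)
  InP1-sym (inj₂ (inj₂ (inj₁ (x≡0 , y≡0))))  = inj₂ (inj₂ (inj₁ (y≡0 , x≡0)))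
  InP1-sym (inj₂ (inj₂ (inj₂ (x≡1 , y≡1))))  = inj₂ (inj₂ (inj₂ (y≡1 , x≡1)))

  InP1-pair : ∀ n → InP1 g (c n) (c n + suc n)
  InP1-pair n = inj₁ (n , refl , c+suc≡floorPhi1+g n)

  InP1-or-move-into : ∀ x y → InP1 g x y ⊎ ∃[ u ] ∃[ v ] (QueenMove x y u v × InP1 g u v)
  InP1-or-move-into = QueenMoveInto.in-P-or-reach (InP1 g) InP1-sym (inj₂ (inj₂ (inj₁ (refl , refl))))
                        (inj₂ (inj₂ (inj₂ (refl , refl)))) c InP1-pair c-mono pair-coordinate

lemma3p12 : (g : ℕ → ℕ) → IsG g → (x y : ℕ) → ¬ InP1 g x y →
            ∃[ u ] ∃[ v ] (QueenMove x y u v × InP1 g u v)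
lemma3p12 g isG x y x,y∉P₁ = [ ⊥-elim ∘ x,y∉P₁ , id ]′ (InP1-or-move-into g isG x y)
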